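{- If $G$ is a connected, claw-free, cubic graph of order $n \ge 10$, then $F(G) < \frac{1}{2}n$.
   Context: Graphs are finite and simple. A graph is claw-free if it contains no induced $K_{1,3}$. Forcing process: given $S \subseteq V(G)$ of initially colored vertices, at each step, if a colored vertex has exactly one non-colored neighbor, that neighbor becomes colored. $S$ is a forcing set (zero forcing set) if iterating this process colors all of $V(G)$; $F(G)$ is the minimum size of a forcing set. -}

module Defs where

open import Data.Nat using (ℕ; zero; suc; _+_)
open import Data.Fin using (Fin)
open import Data.Bool using (Bool; true; false; if_then_else_)
open import Data.List using (List; map; allFin)
open import Data.Nat.ListAction using (sum)
open import Data.Product using (_×_)
open import Data.Fin.Subset using (Subset; _∈_)
open import Relation.Binary.PropositionalEquality using (_≡_)
open import Relation.Nullary using (¬_)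

record Graph (n : ℕ) : Set where
  field
    adj     : Fin n → Fin n → Bool
    adj-sym : ∀ u v → adj u v ≡ adj v u
    irrefl  : ∀ v → adj v v ≡ false
open Graph public

Adj : ∀ {n} → Graph n → Fin n → Fin n → Set
Adj G u v = adj G u v ≡ true

degree : ∀ {n} → Graph n → Fin n → ℕ
degree {n} G u = sum (map (λ v → if adj G u v then 1 else 0) (allFin n))

Cubic : ∀ {n} → Graph n → Set
Cubic G = ∀ u → degree G u ≡ 3

data Reachable {n} (G : Graph n) : Fin n → Fin n → Set where
  here : ∀ {u} → Reachable G u u
  step : ∀ {u w v} → Adj G u w → Reachable G w v → Reachable G u v

Connected : ∀ {n} → Graph n → Set
Connected G = ∀ u v → Reachable G u v

ClawFree : ∀ {n} → Graph n → Set
ClawFree G = ∀ c a b d → Adj G c a → Adj G c b → Adj G c d →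
  ¬ (a ≡ b) → ¬ (a ≡ d) → ¬ (b ≡ d) →
  ¬ (¬ Adj G a b × ¬ Adj G a d × ¬ Adj G b d)

-- Vertices eventually coloured by the forcing process started from S:
-- initially coloured vertices are coloured; if a coloured vertex u has
-- v as a neighbour and all other neighbours of u are coloured (so v is
-- its only possibly non-coloured neighbour), then v gets coloured.
-- (Inductive = least closed set = final result of iterating the rule.)
data Colored {n} (G : Graph n) (S : Subset n) : Fin n → Set where
  initial : ∀ {v} → v ∈ S → Colored G S v
  force   : ∀ {u v} → Colored G S u → Adj G u v →
            (∀ w → Adj G u w → ¬ (w ≡ v) → Colored G S w) →
            Colored G S v

ForcingSet : ∀ {n} → Graph n → Subset n → Set
ForcingSet G S = ∀ v → Colored G S v

module Submission where

open import Defs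
open import Data.Nat using (ℕ; zero; suc; _+_; _*_; _≤_; _<_; _<?_; s≤s; z≤n)
open import Data.Nat.Properties
  using (≤-refl; ≤-trans; ≤-reflexive; n≤1+n; m≤n+m; <⇒≱; m≤n⇒m<n∨m≡n; +-suc; +-comm; +-identityʳ;
         *-suc; +-cancelˡ-≤; +-monoʳ-≤; +-monoˡ-≤; *-monoʳ-≤; module ≤-Reasoning)
open import Data.Nat.ListAction using (sum)
open import Data.Bool using (Bool; true; false; if_then_else_)
open import Data.Bool.Properties using () renaming (_≟_ to _≟ᵇ_)
open import Data.Fin using (Fin; zero; suc; fromℕ<)
open import Data.Fin.Properties using (_≟_; all?; ¬∀⟶∃¬)
open import Data.Fin.Subset using (Subset; ∣_∣; _∈_; _∉_; ⊤; inside; outside) renaming (⊥ to ∅)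
open import Data.Fin.Subset.Properties
  using (_∈?_; ∉⊥; ∈⊤; ∣p∣≤n; ∣p∣≡n⇒p≡⊤; ∣⊥∣≡0; ∣⊤∣≡n; p⊆q⇒∣p∣≤∣q∣)
open import Data.Vec using (_∷_; here; there)
open import Data.List using (List; []; _∷_; length; map; filter; allFin)
open import Data.List.Membership.Propositional using () renaming (_∈_ to _∈ₗ_)
open import Data.List.Membership.Propositional.Properties using (∈-filter⁺; ∈-filter⁻; ∈-allFin)
open import Data.List.Relation.Unary.Any using (here; there)
open import Data.List.Relation.Unary.All using (All; []; _∷_)
open import Data.List.Relation.Unary.AllPairs using ([]; _∷_)
open import Data.List.Relation.Unary.Unique.Propositional using (Unique)
open import Data.List.Relation.Unary.Unique.Propositional.Properties using (allFin⁺; filter⁺)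
open import Data.Product using (Σ; ∃-syntax; _×_; _,_; proj₁; proj₂)
open import Data.Sum using (_⊎_; inj₁; inj₂)
open import Data.Empty using (⊥; ⊥-elim)
open import Relation.Nullary using (¬_; Dec; yes; no)
open import Relation.Nullary.Decidable using (from-yes)
open import Relation.Binary.PropositionalEquality using (_≡_; _≢_; refl; sym; trans; cong; subst; ≢-sym)

-- A configuration of gain g is a partial run of the forcing process: a set C
-- of vertices coloured from S, each with a neighbour in C, such that
-- g + 2|S| ≤ |C| + 3.  Colouring greedily across the boundary of C never
-- loses gain: a boundary vertex u has a neighbour in C, so either u forces
-- its only neighbour outside C (gain + 1), or one of its two outside
-- neighbours is put into S and u forces the other (gain kept).  Once C is
-- everything, gain 4 means 2|S| ≤ n − 1.  A triangle put into S has gain 0;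
-- claw-freeness puts every vertex into a triangle, and a local analysis
-- around it (a diamond, or a triangle with three distinct outer neighbours)
-- finds four gaining forces.  Connectivity and n ≥ 10 exclude the small
-- neighbour-closed vertex sets (of sizes 4, 6, 8) that would block this.

count≡length-filter : ∀ {A : Set} (f : A → Bool) (xs : List A) →
  sum (map (λ v → if f v then 1 else 0) xs) ≡ length (filter (λ v → f v ≟ᵇ true) xs)
count≡length-filter f [] = refl
count≡length-filter f (x ∷ xs) with f x
... | true  = cong suc (count≡length-filter f xs)
... | false = count≡length-filter f xs

listOfThree : ∀ {A : Set} (xs : List A) → Unique xs → length xs ≡ 3 →
  ∃[ x ] ∃[ y ] ∃[ z ] (x ≢ y × x ≢ z × y ≢ z ×
    x ∈ₗ xs × y ∈ₗ xs × z ∈ₗ xs × (∀ {w} → w ∈ₗ xs → w ≡ x ⊎ w ≡ y ⊎ w ≡ z))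
listOfThree (x ∷ y ∷ z ∷ []) ((x≢y ∷ x≢z ∷ []) ∷ (y≢z ∷ []) ∷ [] ∷ []) refl =
  x , y , z , x≢y , x≢z , y≢z , here refl , there (here refl) , there (there (here refl)) , members
  where
  members : ∀ {w} → w ∈ₗ (x ∷ y ∷ z ∷ []) → w ≡ x ⊎ w ≡ y ⊎ w ≡ z
  members (here w≡x)                 = inj₁ w≡x
  members (there (here w≡y))         = inj₂ (inj₁ w≡y)
  members (there (there (here w≡z))) = inj₂ (inj₂ w≡z)

insert : ∀ {n} → Fin n → Subset n → Subset n
insert zero    (_ ∷ p) = inside ∷ p
insert (suc x) (b ∷ p) = b ∷ insert x p

x∈insert : ∀ {n} (x : Fin n) p → x ∈ insert x p
x∈insert zero    (_ ∷ p) = here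
x∈insert (suc x) (_ ∷ p) = there (x∈insert x p)

∈-insert⁺ : ∀ {n} (x : Fin n) {p y} → y ∈ p → y ∈ insert x p
∈-insert⁺ zero    here      = here
∈-insert⁺ zero    (there i) = there i
∈-insert⁺ (suc x) here      = here
∈-insert⁺ (suc x) (there i) = there (∈-insert⁺ x i)

∈-insert⁻ : ∀ {n} (x : Fin n) p {y} → y ∈ insert x p → y ≡ x ⊎ y ∈ p
∈-insert⁻ zero    (_ ∷ p) here      = inj₁ refl
∈-insert⁻ zero    (_ ∷ p) (there i) = inj₂ (there i)
∈-insert⁻ (suc x) (_ ∷ p) here      = inj₂ here
∈-insert⁻ (suc x) (_ ∷ p) (there i) with ∈-insert⁻ x p i
... | inj₁ refl = inj₁ refl
... | inj₂ j    = inj₂ (there j)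

∉-insert : ∀ {n} {x y : Fin n} {p} → y ≢ x → y ∉ p → y ∉ insert x p
∉-insert {x = x} {p = p} y≢x y∉p y∈ with ∈-insert⁻ x p y∈
... | inj₁ y≡x = y≢x y≡x
... | inj₂ y∈p = y∉p y∈p

∣insert∣≤ : ∀ {n} (x : Fin n) p → ∣ insert x p ∣ ≤ suc ∣ p ∣
∣insert∣≤ zero    (inside  ∷ p) = n≤1+n _
∣insert∣≤ zero    (outside ∷ p) = ≤-refl
∣insert∣≤ (suc x) (inside  ∷ p) = s≤s (∣insert∣≤ x p)
∣insert∣≤ (suc x) (outside ∷ p) = ∣insert∣≤ x p

∣insert∣≡ : ∀ {n} (x : Fin n) p → x ∉ p → ∣ insert x p ∣ ≡ suc ∣ p ∣
∣insert∣≡ zero    (inside  ∷ p) x∉ = ⊥-elim (x∉ here)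
∣insert∣≡ zero    (outside ∷ p) x∉ = refl
∣insert∣≡ (suc x) (inside  ∷ p) x∉ = cong suc (∣insert∣≡ x p (λ i → x∉ (there i)))
∣insert∣≡ (suc x) (outside ∷ p) x∉ = ∣insert∣≡ x p (λ i → x∉ (there i))

∣insert²∣≡ : ∀ {n} {x z : Fin n} {p} → x ∉ p → z ∉ p → z ≢ x → ∣ insert z (insert x p) ∣ ≡ suc (suc ∣ p ∣)
∣insert²∣≡ {x = x} {z} {p} x∉ z∉ z≢x =
  trans (∣insert∣≡ z (insert x p) (∉-insert z≢x z∉)) (cong suc (∣insert∣≡ x p x∉))

∉⇒∣p∣<n : ∀ {n} {x : Fin n} (p : Subset n) → x ∉ p → ∣ p ∣ < n
∉⇒∣p∣<n {n} {x} p x∉p with m≤n⇒m<n∨m≡n (∣p∣≤n p)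
... | inj₁ ∣p∣<n = ∣p∣<n
... | inj₂ ∣p∣≡n = ⊥-elim (x∉p (subst (x ∈_) (sym (∣p∣≡n⇒p≡⊤ ∣p∣≡n)) ∈⊤))

fromList : ∀ {n} → List (Fin n) → Subset n
fromList []       = ∅
fromList (x ∷ xs) = insert x (fromList xs)

∈-fromList⁺ : ∀ {n} {xs : List (Fin n)} {x} → x ∈ₗ xs → x ∈ fromList xs
∈-fromList⁺ {xs = y ∷ xs} (here refl) = x∈insert y (fromList xs)
∈-fromList⁺ {xs = y ∷ xs} (there i)   = ∈-insert⁺ y (∈-fromList⁺ i)

∈-fromList⁻ : ∀ {n} (xs : List (Fin n)) {x} → x ∈ fromList xs → x ∈ₗ xs
∈-fromList⁻ []       i = ⊥-elim (∉⊥ i)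
∈-fromList⁻ (y ∷ xs) i with ∈-insert⁻ y (fromList xs) i
... | inj₁ x≡y = here x≡y
... | inj₂ j   = there (∈-fromList⁻ xs j)

∉-fromList : ∀ {n} {x : Fin n} {xs : List (Fin n)} → All (x ≢_) xs → x ∉ fromList xs
∉-fromList []          = ∉⊥
∉-fromList (x≢y ∷ x∉) = ∉-insert x≢y (∉-fromList x∉)

∣fromList∣≤length : ∀ {n} (xs : List (Fin n)) → ∣ fromList xs ∣ ≤ length xs
∣fromList∣≤length {n} []  = ≤-reflexive (∣⊥∣≡0 n)
∣fromList∣≤length (x ∷ xs) = ≤-trans (∣insert∣≤ x (fromList xs)) (s≤s (∣fromList∣≤length xs))

pattern at0 = here refl
pattern at1 = there at0
pattern at2 = there at1
pattern at3 = there at2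
pattern at4 = there at3
pattern at5 = there at4
pattern at6 = there at5
pattern at7 = there at6

module Graphs {n : ℕ} (G : Graph n) where

  adj-sym′ : ∀ {u w} → Adj G u w → Adj G w u
  adj-sym′ {u} {w} u~w = trans (adj-sym G w u) u~w

  adjacent? : ∀ u w → Dec (Adj G u w)
  adjacent? u w = adj G u w ≟ᵇ true

  adj⇒≢ : ∀ {u w} → Adj G u w → u ≢ w
  adj⇒≢ {u} u~w refl with trans (sym u~w) (irrefl G u)
  ... | ()

  record Nbhd (u x y z : Fin n) : Set where
    field
      adj₁ : Adj G u x
      adj₂ : Adj G u y
      adj₃ : Adj G u z
      distinct₁₂ : x ≢ y
      distinct₁₃ : x ≢ z
      distinct₂₃ : y ≢ z
      covers : ∀ w → Adj G u w → w ≡ x ⊎ w ≡ y ⊎ w ≡ z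
  open Nbhd public

  swap₁₂ : ∀ {u x y z} → Nbhd u x y z → Nbhd u y x z
  swap₁₂ N = record
    { adj₁ = N .adj₂ ; adj₂ = N .adj₁ ; adj₃ = N .adj₃
    ; distinct₁₂ = ≢-sym (N .distinct₁₂) ; distinct₁₃ = N .distinct₂₃ ; distinct₂₃ = N .distinct₁₃
    ; covers = λ w u~w → reorder (N .covers w u~w) }
    where
    reorder : ∀ {w x y z : Fin n} → w ≡ x ⊎ w ≡ y ⊎ w ≡ z → w ≡ y ⊎ w ≡ x ⊎ w ≡ z
    reorder (inj₁ e)        = inj₂ (inj₁ e)
    reorder (inj₂ (inj₁ e)) = inj₁ e
    reorder (inj₂ (inj₂ e)) = inj₂ (inj₂ e)

  swap₂₃ : ∀ {u x y z} → Nbhd u x y z → Nbhd u x z y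
  swap₂₃ N = record
    { adj₁ = N .adj₁ ; adj₂ = N .adj₃ ; adj₃ = N .adj₂
    ; distinct₁₂ = N .distinct₁₃ ; distinct₁₃ = N .distinct₁₂ ; distinct₂₃ = ≢-sym (N .distinct₂₃)
    ; covers = λ w u~w → reorder (N .covers w u~w) }
    where
    reorder : ∀ {w x y z : Fin n} → w ≡ x ⊎ w ≡ y ⊎ w ≡ z → w ≡ x ⊎ w ≡ z ⊎ w ≡ y
    reorder (inj₁ e)        = inj₁ e
    reorder (inj₂ (inj₁ e)) = inj₂ (inj₂ e)
    reorder (inj₂ (inj₂ e)) = inj₂ (inj₁ e)

  nonNeighbour : ∀ {u x y z w} → Nbhd u x y z → w ≢ x → w ≢ y → w ≢ z → ¬ Adj G u w
  nonNeighbour N w≢x w≢y w≢z u~w with N .covers _ u~w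
  ... | inj₁ e        = w≢x e
  ... | inj₂ (inj₁ e) = w≢y e
  ... | inj₂ (inj₂ e) = w≢z e

  distinctVia : ∀ {s t w} → ¬ Adj G t s → Adj G w s → w ≢ t
  distinctVia t≁s w~s refl = t≁s w~s

  clawFree⇒adjacent : ClawFree G → ∀ {c x y z} → Nbhd c x y z →
                      ¬ Adj G x y → ¬ Adj G x z → Adj G y z
  clawFree⇒adjacent clawFree {c} {x} {y} {z} N x≁y x≁z with adjacent? y z
  ... | yes y~z = y~z
  ... | no  y≁z = ⊥-elim (clawFree c x y z (N .adj₁) (N .adj₂) (N .adj₃)
                    (N .distinct₁₂) (N .distinct₁₃) (N .distinct₂₃) (x≁y , x≁z , y≁z))

  thirdNeighbour≡ : ClawFree G → ∀ {c₁ c c₂ x y z} → Nbhd c₁ c c₂ x → Nbhd x y c₁ z →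
                    ¬ Adj G c x → ¬ Adj G y c₁ → ¬ Adj G y z → z ≡ c₂
  thirdNeighbour≡ clawFree N₁ Nx c≁x y≁c₁ y≁z
    with N₁ .covers _ (clawFree⇒adjacent clawFree Nx y≁c₁ y≁z)
  ... | inj₁ refl        = ⊥-elim (c≁x (adj-sym′ (Nx .adj₃)))
  ... | inj₂ (inj₁ z≡c₂) = z≡c₂
  ... | inj₂ (inj₂ refl) = ⊥-elim (adj⇒≢ (Nx .adj₃) refl)

  reachable-closed : (P : Fin n → Set) → (∀ {u w} → P u → Adj G u w → P w) →
                     ∀ {a b} → Reachable G a b → P a → P b
  reachable-closed P closed here         Pa = Pa
  reachable-closed P closed (step a~w r) Pa = reachable-closed P closed r (closed Pa a~w)

  closedList : Connected G → ∀ (L : List (Fin n)) {w} → w ∈ₗ L →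
               (∀ {u x} → u ∈ₗ L → Adj G u x → x ∈ₗ L) → n ≤ length L
  closedList connected L w∈L closed = ≤-trans n≤∣L∣ (∣fromList∣≤length L)
    where
    everywhere : ∀ {x} → x ∈ ⊤ → x ∈ fromList L
    everywhere {x} _ = ∈-fromList⁺ (reachable-closed (_∈ₗ L) closed (connected _ x) w∈L)
    n≤∣L∣ : n ≤ ∣ fromList L ∣
    n≤∣L∣ = subst (_≤ ∣ fromList L ∣) (∣⊤∣≡n n) (p⊆q⇒∣p∣≤∣q∣ everywhere)

  coverIn : ∀ {L u x y z} → Nbhd u x y z → x ∈ₗ L → y ∈ₗ L → z ∈ₗ L →
            ∀ {w} → Adj G u w → w ∈ₗ L
  coverIn N x∈ y∈ z∈ u~w with N .covers _ u~w
  ... | inj₁ refl        = x∈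
  ... | inj₂ (inj₁ refl) = y∈
  ... | inj₂ (inj₂ refl) = z∈

  boundaryEdge : ∀ (C : Subset n) {a b} → Reachable G a b → a ∈ C → b ∉ C →
                 ∃[ u ] ∃[ x ] (u ∈ C × x ∉ C × Adj G u x)
  boundaryEdge C here a∈ b∉ = ⊥-elim (b∉ a∈)
  boundaryEdge C (step {w = w} a~w r) a∈ b∉ with w ∈? C
  ... | yes w∈ = boundaryEdge C r w∈ b∉
  ... | no  w∉ = _ , w , a∈ , w∉ , a~w

  colored-mono : ∀ {S S′ : Subset n} → (∀ {w} → w ∈ S → w ∈ S′) →
                 ∀ {v} → Colored G S v → Colored G S′ v
  colored-mono S⊆S′ (initial v∈S)       = initial (S⊆S′ v∈S)
  colored-mono S⊆S′ (force cu u~v rest) =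
    force (colored-mono S⊆S′ cu) u~v (λ w u~w w≢v → colored-mono S⊆S′ (rest w u~w w≢v))

  module CubicGraphs (cubic : Cubic G) where

    neighbours : Fin n → List (Fin n)
    neighbours u = filter (λ v → adj G u v ≟ᵇ true) (allFin n)

    neighbourhood : ∀ u → ∃[ x ] ∃[ y ] ∃[ z ] Nbhd u x y z
    neighbourhood u
      with listOfThree (neighbours u) (filter⁺ _ (allFin⁺ n))
             (trans (sym (count≡length-filter (adj G u) (allFin n))) (cubic u))
    ... | x , y , z , x≢y , x≢z , y≢z , x∈ , y∈ , z∈ , members = x , y , z , record
      { adj₁ = adjacent x∈ ; adj₂ = adjacent y∈ ; adj₃ = adjacent z∈
      ; distinct₁₂ = x≢y ; distinct₁₃ = x≢z ; distinct₂₃ = y≢z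
      ; covers = λ w u~w → members (∈-filter⁺ _ (∈-allFin w) u~w) }
      where
      adjacent : ∀ {v} → v ∈ₗ neighbours u → Adj G u v
      adjacent v∈ = proj₂ (∈-filter⁻ _ {xs = allFin n} v∈)

    complete : ∀ {u x y} → Adj G u x → Adj G u y → x ≢ y → ∃[ z ] Nbhd u x y z
    complete {u} u~x u~y x≢y with neighbourhood u
    ... | p , q , r , N with N .covers _ u~x | N .covers _ u~y
    ... | inj₁ refl        | inj₁ refl        = ⊥-elim (x≢y refl)
    ... | inj₁ refl        | inj₂ (inj₁ refl) = r , N
    ... | inj₁ refl        | inj₂ (inj₂ refl) = q , swap₂₃ N
    ... | inj₂ (inj₁ refl) | inj₁ refl        = r , swap₁₂ N
    ... | inj₂ (inj₁ refl) | inj₂ (inj₁ refl) = ⊥-elim (x≢y refl)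
    ... | inj₂ (inj₁ refl) | inj₂ (inj₂ refl) = p , swap₂₃ (swap₁₂ N)
    ... | inj₂ (inj₂ refl) | inj₁ refl        = q , swap₁₂ (swap₂₃ N)
    ... | inj₂ (inj₂ refl) | inj₂ (inj₁ refl) = p , swap₁₂ (swap₂₃ (swap₁₂ N))
    ... | inj₂ (inj₂ refl) | inj₂ (inj₂ refl) = ⊥-elim (x≢y refl)

    completeFrom : ∀ {u x} → Adj G u x → ∃[ y ] ∃[ z ] Nbhd u x y z
    completeFrom {u} u~x with neighbourhood u
    ... | p , q , r , N with N .covers _ u~x
    ... | inj₁ refl        = q , r , N
    ... | inj₂ (inj₁ refl) = p , r , swap₁₂ N
    ... | inj₂ (inj₂ refl) = p , q , swap₁₂ (swap₂₃ N)

    nbhdOf : ∀ {u x y z} → Adj G u x → Adj G u y → Adj G u z →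
             x ≢ y → x ≢ z → y ≢ z → Nbhd u x y z
    nbhdOf u~x u~y u~z x≢y x≢z y≢z with complete u~x u~y x≢y
    ... | z′ , N with N .covers _ u~z
    ... | inj₁ refl        = ⊥-elim (x≢z refl)
    ... | inj₂ (inj₁ refl) = ⊥-elim (y≢z refl)
    ... | inj₂ (inj₂ refl) = N

    triangleAt : ClawFree G → ∀ v → ∃[ a ] ∃[ b ] ∃[ c ] (Nbhd v a b c × Adj G a b)
    triangleAt clawFree v with neighbourhood v
    ... | x , y , z , N with adjacent? x y | adjacent? x z
    ... | yes x~y | _       = x , y , z , N , x~y
    ... | no _    | yes x~z = x , z , y , swap₂₃ N , x~z
    ... | no x≁y  | no x≁z  = y , z , x , swap₂₃ (swap₁₂ N) , clawFree⇒adjacent clawFree N x≁y x≁z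

    record Config (g : ℕ) (C : Subset n) : Set where
      field
        S       : Subset n
        colored : ∀ {v} → v ∈ C → Colored G S v
        inner   : ∀ {v} → v ∈ C → ∃[ w ] (Adj G v w × w ∈ C)
        root    : Fin n
        root∈C  : root ∈ C
        balance : g + 2 * ∣ S ∣ ≤ ∣ C ∣ + 3
    open Config

    -- A vertex u of C whose neighbours other than x lie in C forces x:
    -- C grows by one and S is unchanged, so the gain increases.
    forceStep : ∀ {g C u y z x} → Config g C → Nbhd u y z x →
                u ∈ C → y ∈ C → z ∈ C → x ∉ C → Config (suc g) (insert x C)
    forceStep {g} {C} {u} {y} {z} {x} κ N u∈ y∈ z∈ x∉ = record
      { S = S κ ; colored = colored′ ; inner = inner′
      ; root = root κ ; root∈C = ∈-insert⁺ x (root∈C κ)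
      ; balance = subst (λ k → suc g + 2 * ∣ S κ ∣ ≤ k + 3) (sym (∣insert∣≡ x C x∉)) (s≤s (balance κ)) }
      where
      othersColored : ∀ w → Adj G u w → w ≢ x → Colored G (S κ) w
      othersColored w u~w w≢x with N .covers w u~w
      ... | inj₁ refl        = colored κ y∈
      ... | inj₂ (inj₁ refl) = colored κ z∈
      ... | inj₂ (inj₂ w≡x)  = ⊥-elim (w≢x w≡x)
      colored′ : ∀ {v} → v ∈ insert x C → Colored G (S κ) v
      colored′ {v} v∈ with ∈-insert⁻ x C v∈
      ... | inj₁ refl = force (colored κ u∈) (N .adj₃) othersColored
      ... | inj₂ v∈C  = colored κ v∈C
      inner′ : ∀ {v} → v ∈ insert x C → ∃[ w ] (Adj G v w × w ∈ insert x C)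
      inner′ {v} v∈ with ∈-insert⁻ x C v∈
      ... | inj₁ refl = u , adj-sym′ (N .adj₃) , ∈-insert⁺ x u∈
      ... | inj₂ v∈C  = let (w , v~w , w∈) = inner κ v∈C in w , v~w , ∈-insert⁺ x w∈

    -- A vertex u of C whose only neighbour in C is y: put x into S, after
    -- which u forces z.  C grows by two and S by one, so the gain is kept.
    guessStep : ∀ {g C u y x z} → Config g C → Nbhd u y x z →
                u ∈ C → y ∈ C → x ∉ C → z ∉ C → Config g (insert z (insert x C))
    guessStep {g} {C} {u} {y} {x} {z} κ N u∈ y∈ x∉ z∉ = record
      { S = S′ ; colored = colored′ ; inner = inner′
      ; root = root κ ; root∈C = grow (root∈C κ)
      ; balance = balance′ }
      where
      S′ = insert x (S κ)
      C′ = insert z (insert x C)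
      grow : ∀ {w} → w ∈ C → w ∈ C′
      grow w∈ = ∈-insert⁺ z (∈-insert⁺ x w∈)
      old : ∀ {w} → w ∈ C → Colored G S′ w
      old w∈ = colored-mono (∈-insert⁺ x) (colored κ w∈)
      x∈S′ : Colored G S′ x
      x∈S′ = initial (x∈insert x (S κ))
      othersColored : ∀ w → Adj G u w → w ≢ z → Colored G S′ w
      othersColored w u~w w≢z with N .covers w u~w
      ... | inj₁ refl        = old y∈
      ... | inj₂ (inj₁ refl) = x∈S′
      ... | inj₂ (inj₂ w≡z)  = ⊥-elim (w≢z w≡z)
      colored′ : ∀ {v} → v ∈ C′ → Colored G S′ v
      colored′ {v} v∈ with ∈-insert⁻ z (insert x C) v∈
      ... | inj₁ refl = force (old u∈) (N .adj₃) othersColored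
      ... | inj₂ v∈′ with ∈-insert⁻ x C v∈′
      ...   | inj₁ refl = x∈S′
      ...   | inj₂ v∈C  = old v∈C
      inner′ : ∀ {v} → v ∈ C′ → ∃[ w ] (Adj G v w × w ∈ C′)
      inner′ {v} v∈ with ∈-insert⁻ z (insert x C) v∈
      ... | inj₁ refl = u , adj-sym′ (N .adj₃) , grow u∈
      ... | inj₂ v∈′ with ∈-insert⁻ x C v∈′
      ...   | inj₁ refl = u , adj-sym′ (N .adj₂) , grow u∈
      ...   | inj₂ v∈C  = let (w , v~w , w∈) = inner κ v∈C in w , v~w , grow w∈
      balance′ : g + 2 * ∣ S′ ∣ ≤ ∣ C′ ∣ + 3
      balance′ = begin
        g + 2 * ∣ S′ ∣              ≤⟨ +-monoʳ-≤ g (*-monoʳ-≤ 2 (∣insert∣≤ x (S κ))) ⟩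
        g + 2 * suc ∣ S κ ∣         ≡⟨ cong (g +_) (*-suc 2 ∣ S κ ∣) ⟩
        g + suc (suc (2 * ∣ S κ ∣)) ≡⟨ trans (+-suc g _) (cong suc (+-suc g _)) ⟩
        suc (suc (g + 2 * ∣ S κ ∣)) ≤⟨ s≤s (s≤s (balance κ)) ⟩
        suc (suc (∣ C ∣ + 3))       ≡⟨ cong (_+ 3) (sym (∣insert²∣≡ x∉ z∉ (≢-sym (N .distinct₂₃)))) ⟩
        ∣ C′ ∣ + 3                  ∎
        where open ≤-Reasoning

    Extension : ℕ → Set
    Extension g = ∃[ S ] (ForcingSet G S × g + 2 * ∣ S ∣ ≤ n + 3)

    -- While C misses a vertex, connectivity gives an edge
    -- u–x leaving C, and u has a neighbour w in C; if u's third neighbour y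
    -- lies in C then u forces x, otherwise x goes into S and u forces y.
    -- The fuel bounds the number of vertices outside C.
    extend : Connected G → ∀ {g C} (fuel : ℕ) → n ≤ ∣ C ∣ + fuel → Config g C → Extension g
    extend connected {g} {C} fuel enough κ with all? (_∈? C)
    ... | yes all∈C = S κ , (λ v → colored κ (all∈C v)) , ≤-trans (balance κ) (+-monoˡ-≤ 3 (∣p∣≤n C))
    ... | no ¬all∈C with ¬∀⟶∃¬ n _ (_∈? C) ¬all∈C
    ... | v , v∉ with boundaryEdge C (connected (root κ) v) (root∈C κ) v∉
    ... | u , x , u∈ , x∉ , u~x with inner κ u∈
    ... | w , u~w , w∈ with complete u~w u~x (λ { refl → x∉ w∈ }) | fuel | enough
    ... | y , N | zero | enough₀ = ⊥-elim (<⇒≱ (∉⇒∣p∣<n C x∉) (subst (n ≤_) (+-identityʳ _) enough₀))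
    ... | y , N | suc fuel′ | enough₁ with y ∈? C
    ...   | yes y∈ = lower (extend connected fuel′ enough′ (forceStep κ (swap₂₃ N) u∈ w∈ y∈ x∉))
      where
      enough′ : n ≤ ∣ insert x C ∣ + fuel′
      enough′ = subst (λ k → n ≤ k + fuel′) (sym (∣insert∣≡ x C x∉)) (subst (n ≤_) (+-suc _ fuel′) enough₁)
      lower : Extension (suc g) → Extension g
      lower (S , forcing , bound) = S , forcing , ≤-trans (n≤1+n _) bound
    ...   | no y∉ = extend connected fuel′ enough′ (guessStep κ N u∈ w∈ x∉ y∉)
      where
      enough′ : n ≤ ∣ insert y (insert x C) ∣ + fuel′
      enough′ = begin
        n                                 ≤⟨ enough₁ ⟩
        ∣ C ∣ + suc fuel′                 ≡⟨ +-suc _ fuel′ ⟩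
        suc ∣ C ∣ + fuel′                 ≤⟨ +-monoˡ-≤ fuel′ (n≤1+n _) ⟩
        suc (suc ∣ C ∣) + fuel′           ≡⟨ cong (_+ fuel′) (sym (∣insert²∣≡ x∉ y∉ (≢-sym (N .distinct₂₃)))) ⟩
        ∣ insert y (insert x C) ∣ + fuel′ ∎
        where open ≤-Reasoning

    belowHalf : Connected G → ∀ {C} → Config 4 C → ∃[ S ] (ForcingSet G S × 2 * ∣ S ∣ < n)
    belowHalf connected κ with extend connected n (m≤n+m n _) κ
    ... | S , forcing , bound =
      S , forcing , +-cancelˡ-≤ 3 _ _ (subst (4 + 2 * ∣ S ∣ ≤_) (+-comm n 3) bound)

    triangle : ∀ {v a b} → Adj G v a → Adj G v b → Adj G a b →
               Config 0 (fromList (b ∷ a ∷ v ∷ []))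
    triangle {v} {a} {b} v~a v~b a~b = record
      { S = C ; colored = initial ; inner = inner′
      ; root = v ; root∈C = ∈-fromList⁺ {xs = L} at2
      ; balance = +-monoʳ-≤ ∣ C ∣ (subst (_≤ 3) (sym (+-identityʳ ∣ C ∣)) (∣fromList∣≤length L)) }
      where
      L : List (Fin n)
      L = b ∷ a ∷ v ∷ []
      C = fromList L
      inner′ : ∀ {u} → u ∈ C → ∃[ w ] (Adj G u w × w ∈ C)
      inner′ u∈ with ∈-fromList⁻ L u∈
      ... | at0 = a , adj-sym′ a~b , ∈-fromList⁺ {xs = L} at1
      ... | at1 = b , a~b , ∈-fromList⁺ {xs = L} at0
      ... | at2 = a , v~a , ∈-fromList⁺ {xs = L} at1

    forceL : ∀ {g L u y z x} → Config g (fromList L) → Nbhd u y z x →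
             u ∈ₗ L → y ∈ₗ L → z ∈ₗ L → All (x ≢_) L → Config (suc g) (fromList (x ∷ L))
    forceL κ N u∈ y∈ z∈ x∉ = forceStep κ N (∈-fromList⁺ u∈) (∈-fromList⁺ y∈) (∈-fromList⁺ z∈) (∉-fromList x∉)

    guessL : ∀ {g L u y x z} → Config g (fromList L) → Nbhd u y x z →
             u ∈ₗ L → y ∈ₗ L → All (x ≢_) L → All (z ≢_) L → Config g (fromList (z ∷ x ∷ L))
    guessL κ N u∈ y∈ x∉ z∉ = guessStep κ N (∈-fromList⁺ u∈) (∈-fromList⁺ y∈) (∉-fromList x∉) (∉-fromList z∉)

    Gain4 : Set
    Gain4 = ∃[ C ] Config 4 C

    module LocalAnalysis (clawFree : ClawFree G) (connected : Connected G) (big : 10 ≤ n) where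

      noSmallClosed : ∀ (L : List (Fin n)) {w} → w ∈ₗ L →
                      (∀ {u x} → u ∈ₗ L → Adj G u x → x ∈ₗ L) → length L < 10 → ⊥
      noSmallClosed L w∈ closed short = <⇒≱ (≤-trans short big) (closedList connected L w∈ closed)

      noK₄ : ∀ {p a b q} → Adj G a b → Adj G p a → Adj G p b → Adj G q a → Adj G q b → Adj G p q → ⊥
      noK₄ {p} {a} {b} {q} a~b p~a p~b q~a q~b p~q = noSmallClosed K₄ at0 closed (from-yes (4 <? 10))
        where
        K₄ : List (Fin n)
        K₄ = p ∷ a ∷ b ∷ q ∷ []
        a≢b = adj⇒≢ a~b ; p≢a = adj⇒≢ p~a ; p≢b = adj⇒≢ p~b ; q≢a = adj⇒≢ q~a ; q≢b = adj⇒≢ q~b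
        p≢q = adj⇒≢ p~q
        closed : ∀ {u x} → u ∈ₗ K₄ → Adj G u x → x ∈ₗ K₄
        closed at0 = coverIn (nbhdOf p~a p~b p~q a≢b (≢-sym q≢a) (≢-sym q≢b)) at1 at2 at3
        closed at1 = coverIn (nbhdOf (adj-sym′ p~a) (adj-sym′ q~a) a~b p≢q p≢b q≢b) at0 at3 at2
        closed at2 = coverIn (nbhdOf (adj-sym′ p~b) (adj-sym′ q~b) (adj-sym′ a~b) p≢q p≢a q≢a) at0 at3 at1
        closed at3 = coverIn (nbhdOf q~a q~b (adj-sym′ p~q) a≢b (≢-sym p≢a) (≢-sym p≢b)) at1 at2 at0

      -- An induced diamond: the edge a–b has two non-adjacent common
      -- neighbours p and q, whose third neighbours are p′ and q′.  Colour the
      -- triangle p a b; p forces p′, a forces q, q forces q′ (gain 3).  The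
      -- fourth gain comes from the two other neighbours r, s of p′.
      module Diamond {p a b q} (a~b : Adj G a b) (p~a : Adj G p a) (p~b : Adj G p b)
                     (q~a : Adj G q a) (q~b : Adj G q b) (p≢q : p ≢ q) (p≁q : ¬ Adj G p q) where

        a≢b = adj⇒≢ a~b ; p≢a = adj⇒≢ p~a ; p≢b = adj⇒≢ p~b ; q≢a = adj⇒≢ q~a ; q≢b = adj⇒≢ q~b

        NA : Nbhd a p q b
        NA = nbhdOf (adj-sym′ p~a) (adj-sym′ q~a) a~b p≢q p≢b q≢b
        NB : Nbhd b p q a
        NB = nbhdOf (adj-sym′ p~b) (adj-sym′ q~b) (adj-sym′ a~b) p≢q p≢a q≢a
        p′ = proj₁ (complete p~a p~b a≢b)
        NP : Nbhd p a b p′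
        NP = proj₂ (complete p~a p~b a≢b)
        q′ = proj₁ (complete q~a q~b a≢b)
        NQ : Nbhd q a b q′
        NQ = proj₂ (complete q~a q~b a≢b)

        p′≢p = ≢-sym (adj⇒≢ (NP .adj₃)) ; q′≢q = ≢-sym (adj⇒≢ (NQ .adj₃))
        p′≢q : p′ ≢ q
        p′≢q refl = p≁q (NP .adj₃)
        q′≢p : q′ ≢ p
        q′≢p refl = p≁q (adj-sym′ (NQ .adj₃))
        a≁p′ : ¬ Adj G a p′
        a≁p′ = nonNeighbour NA p′≢p p′≢q (≢-sym (NP .distinct₂₃))
        b≁p′ : ¬ Adj G b p′
        b≁p′ = nonNeighbour NB p′≢p p′≢q (≢-sym (NP .distinct₁₃))

        notA : ∀ {w} → Adj G p′ w → w ≢ a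
        notA p′~w = distinctVia a≁p′ (adj-sym′ p′~w)
        notB : ∀ {w} → Adj G p′ w → w ≢ b
        notB p′~w = distinctVia b≁p′ (adj-sym′ p′~w)

        -- p′ ≠ q′: otherwise the non-adjacent p and q would form a claw at p′
        -- together with its third neighbour t
        p′≢q′ : p′ ≢ q′
        p′≢q′ p′≡q′ = nonNeighbour NQ t≢a t≢b (subst (t ≢_) p′≡q′ t≢p′) q~t
          where
          q~p′ = subst (Adj G q) (sym p′≡q′) (NQ .adj₃)
          t = proj₁ (complete (adj-sym′ (NP .adj₃)) (adj-sym′ q~p′) p≢q)
          Nt : Nbhd p′ p q t
          Nt = proj₂ (complete (adj-sym′ (NP .adj₃)) (adj-sym′ q~p′) p≢q)
          t≢a = notA (Nt .adj₃) ; t≢b = notB (Nt .adj₃) ; t≢p′ = ≢-sym (adj⇒≢ (Nt .adj₃))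
          q~t : Adj G q t
          q~t = clawFree⇒adjacent clawFree Nt p≁q (nonNeighbour NP t≢a t≢b t≢p′)

        q≁p′ : ¬ Adj G q p′
        q≁p′ = nonNeighbour NQ (≢-sym (NP .distinct₁₃)) (≢-sym (NP .distinct₂₃)) p′≢q′

        L₃ : List (Fin n)
        L₃ = q′ ∷ q ∷ p′ ∷ b ∷ a ∷ p ∷ []
        κ₃ : Config 3 (fromList L₃)
        κ₃ = forceL κ₂ NQ at0 at3 at2
               (q′≢q ∷ ≢-sym p′≢q′ ∷ ≢-sym (NQ .distinct₂₃) ∷ ≢-sym (NQ .distinct₁₃) ∷ q′≢p ∷ [])
          where
          κ₁ : Config 1 (fromList (p′ ∷ b ∷ a ∷ p ∷ []))
          κ₁ = forceL (triangle p~a p~b a~b) NP at2 at1 at0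
                 (≢-sym (NP .distinct₂₃) ∷ ≢-sym (NP .distinct₁₃) ∷ p′≢p ∷ [])
          κ₂ : Config 2 (fromList (q ∷ p′ ∷ b ∷ a ∷ p ∷ []))
          κ₂ = forceL κ₁ (swap₂₃ NA) at2 at3 at1 (≢-sym p′≢q ∷ q≢b ∷ q≢a ∷ ≢-sym p≢q ∷ [])

        freshNeighbour : ∀ {w} → Adj G p′ w → p ≢ w → All (w ≢_) (q ∷ p′ ∷ b ∷ a ∷ p ∷ [])
        freshNeighbour p′~w p≢w =
          distinctVia q≁p′ (adj-sym′ p′~w) ∷ ≢-sym (adj⇒≢ p′~w) ∷ notB p′~w ∷ notA p′~w ∷ ≢-sym p≢w ∷ []
        farNeighbour : ∀ {w t} → Adj G p′ w → p ≢ w → w ≢ q′ → Adj G w t → t ≢ p′ →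
                       All (t ≢_) (q ∷ p′ ∷ b ∷ a ∷ p ∷ [])
        farNeighbour p′~w p≢w w≢q′ w~t t≢p′ =
          distinctVia (nonNeighbour NQ w≢a w≢b w≢q′) t~w ∷ t≢p′ ∷
          distinctVia (nonNeighbour NB w≢p w≢q w≢a) t~w ∷ distinctVia (nonNeighbour NA w≢p w≢q w≢b) t~w ∷
          distinctVia (nonNeighbour NP w≢a w≢b (≢-sym (adj⇒≢ p′~w))) t~w ∷ []
          where
          t~w = adj-sym′ w~t
          w≢a = notA p′~w ; w≢b = notB p′~w ; w≢p = ≢-sym p≢w
          w≢q = distinctVia q≁p′ (adj-sym′ p′~w)

        -- the other two neighbours of p′ are adjacent, as p is adjacent to neither
        sideEdge : ∀ {r s} → Nbhd p′ p r s → Adj G r s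
        sideEdge Np′ = clawFree⇒adjacent clawFree Np′ (p≁ (Np′ .adj₂)) (p≁ (Np′ .adj₃))
          where
          p≁ : ∀ {w} → Adj G p′ w → ¬ Adj G p w
          p≁ p′~w = nonNeighbour NP (notA p′~w) (notB p′~w) (≢-sym (adj⇒≢ p′~w))

        -- If neither r nor s is q′: put r into S and let p′ force s.
        κ₄ : ∀ {r s} → Nbhd p′ p r s → r ≢ q′ → s ≢ q′ → Config 3 (fromList (s ∷ r ∷ L₃))
        κ₄ Np′ r≢q′ s≢q′ = guessL κ₃ Np′ at2 at5 (r≢q′ ∷ freshNeighbour (Np′ .adj₂) (Np′ .distinct₁₂))
                                                  (s≢q′ ∷ freshNeighbour (Np′ .adj₃) (Np′ .distinct₁₃))

        -- Then r or s has its third neighbour outside the coloured set, and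
        -- forces it: if both were q′, the eight coloured vertices would be
        -- closed under taking neighbours.
        afterGuess : ∀ {r s} → Nbhd p′ p r s → r ≢ q′ → s ≢ q′ → Gain4
        afterGuess {r} {s} Np′ r≢q′ s≢q′
          with complete (adj-sym′ (Np′ .adj₂)) (sideEdge Np′) (adj⇒≢ (Np′ .adj₃))
        ... | r₃ , Nr with r₃ ≟ q′
        ... | no r₃≢q′ = _ , forceL (κ₄ Np′ r≢q′ s≢q′) Nr at1 at4 at0
              (≢-sym (Nr .distinct₂₃) ∷ ≢-sym (adj⇒≢ (Nr .adj₃)) ∷ r₃≢q′ ∷
               farNeighbour (Np′ .adj₂) (Np′ .distinct₁₂) r≢q′ (Nr .adj₃) (≢-sym (Nr .distinct₁₃)))
        ... | yes refl
          with complete (adj-sym′ (Np′ .adj₃)) (adj-sym′ (sideEdge Np′)) (adj⇒≢ (Np′ .adj₂))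
        ... | s₃ , Ns with s₃ ≟ q′
        ... | no s₃≢q′ = _ , forceL (κ₄ Np′ r≢q′ s≢q′) Ns at0 at4 at1
              (≢-sym (adj⇒≢ (Ns .adj₃)) ∷ ≢-sym (Ns .distinct₂₃) ∷ s₃≢q′ ∷
               farNeighbour (Np′ .adj₃) (Np′ .distinct₁₃) s≢q′ (Ns .adj₃) (≢-sym (Ns .distinct₁₃)))
        ... | yes refl = ⊥-elim (noSmallClosed L₄ at0 closed (from-yes (8 <? 10)))
          where
          L₄ : List (Fin n)
          L₄ = s ∷ r ∷ L₃
          Nq′ : Nbhd q′ q r s
          Nq′ = nbhdOf (adj-sym′ (NQ .adj₃)) (adj-sym′ (Nr .adj₃)) (adj-sym′ (Ns .adj₃))
                  (≢-sym (distinctVia q≁p′ (adj-sym′ (Np′ .adj₂))))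
                  (≢-sym (distinctVia q≁p′ (adj-sym′ (Np′ .adj₃)))) (Np′ .distinct₂₃)
          closed : ∀ {u x} → u ∈ₗ L₄ → Adj G u x → x ∈ₗ L₄
          closed at0 = coverIn Ns at4 at1 at2
          closed at1 = coverIn Nr at4 at0 at2
          closed at2 = coverIn Nq′ at3 at1 at0
          closed at3 = coverIn NQ at6 at5 at2
          closed at4 = coverIn Np′ at7 at1 at0
          closed at5 = coverIn NB at7 at3 at6
          closed at6 = coverIn NA at7 at3 at5
          closed at7 = coverIn NP at6 at5 at4

        -- If one of r, s is q′, then p′ forces the other.
        gain4 : Gain4
        gain4 with completeFrom (adj-sym′ (NP .adj₃))
        ... | r , s , Np′ with r ≟ q′ | s ≟ q′
        ... | yes refl | _ = _ , forceL κ₃ Np′ at2 at5 at0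
                                (≢-sym (Np′ .distinct₂₃) ∷ freshNeighbour (Np′ .adj₃) (Np′ .distinct₁₃))
        ... | no _ | yes refl = _ , forceL κ₃ (swap₂₃ Np′) at2 at5 at0
                                   (Np′ .distinct₂₃ ∷ freshNeighbour (Np′ .adj₂) (Np′ .distinct₁₂))
        ... | no r≢q′ | no s≢q′ = afterGuess Np′ r≢q′ s≢q′

      -- Every diamond, i.e. edge a–b with two common neighbours p ≠ q, leads
      -- to gain 4 (p and q are not adjacent, as G is not K₄).
      diamond : ∀ {p a b q} → Adj G a b → Adj G p a → Adj G p b → Adj G q a → Adj G q b →
                p ≢ q → Gain4
      diamond {p} {a} {b} {q} a~b p~a p~b q~a q~b p≢q with adjacent? p q
      ... | yes p~q = ⊥-elim (noK₄ a~b p~a p~b q~a q~b p~q)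
      ... | no p≁q  = Diamond.gain4 a~b p~a p~b q~a q~b p≢q p≁q

      -- A triangle v a b whose outer neighbours c (of v), α (of a), β (of b)
      -- are distinct.  Colour the triangle; v, a, b force c, α, β (gain 3).
      -- The fourth gain is found at the other neighbours c₁, c₂ of c, unless
      -- a diamond turns up there.
      module Pendant {v a b c α β} (NV : Nbhd v a b c) (NA : Nbhd a v b α) (NB : Nbhd b v a β)
                     (α≢c : α ≢ c) (β≢c : β ≢ c) (α≢β : α ≢ β) where

        c≢v = ≢-sym (adj⇒≢ (NV .adj₃)) ; c≢a = ≢-sym (NV .distinct₁₃) ; c≢b = ≢-sym (NV .distinct₂₃)
        α≢v = ≢-sym (NA .distinct₁₃) ; α≢a = ≢-sym (adj⇒≢ (NA .adj₃)) ; α≢b = ≢-sym (NA .distinct₂₃)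
        β≢v = ≢-sym (NB .distinct₁₃) ; β≢a = ≢-sym (NB .distinct₂₃) ; β≢b = ≢-sym (adj⇒≢ (NB .adj₃))

        a≁c : ¬ Adj G a c
        a≁c = nonNeighbour NA c≢v c≢b (≢-sym α≢c)
        b≁c : ¬ Adj G b c
        b≁c = nonNeighbour NB c≢v c≢a (≢-sym β≢c)
        v≁α : ¬ Adj G v α
        v≁α = nonNeighbour NV α≢a α≢b α≢c
        b≁α : ¬ Adj G b α
        b≁α = nonNeighbour NB α≢v α≢a α≢β
        v≁β : ¬ Adj G v β
        v≁β = nonNeighbour NV β≢a β≢b β≢c
        a≁β : ¬ Adj G a β
        a≁β = nonNeighbour NA β≢v β≢b (≢-sym α≢β)

        L₃ : List (Fin n)
        L₃ = β ∷ α ∷ c ∷ b ∷ a ∷ v ∷ []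
        κ₃ : Config 3 (fromList L₃)
        κ₃ = forceL κ₂ NB at2 at4 at3 (≢-sym α≢β ∷ β≢c ∷ β≢b ∷ β≢a ∷ β≢v ∷ [])
          where
          κ₁ : Config 1 (fromList (c ∷ b ∷ a ∷ v ∷ []))
          κ₁ = forceL (triangle (NV .adj₁) (NV .adj₂) (NA .adj₂)) NV at2 at1 at0 (c≢b ∷ c≢a ∷ c≢v ∷ [])
          κ₂ : Config 2 (fromList (α ∷ c ∷ b ∷ a ∷ v ∷ []))
          κ₂ = forceL κ₁ NA at2 at3 at1 (α≢c ∷ α≢b ∷ α≢a ∷ α≢v ∷ [])

        notA : ∀ {w} → Adj G c w → w ≢ a
        notA c~w = distinctVia a≁c (adj-sym′ c~w)
        notB : ∀ {w} → Adj G c w → w ≢ b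
        notB c~w = distinctVia b≁c (adj-sym′ c~w)

        v≁ : ∀ {w} → Adj G c w → ¬ Adj G v w
        v≁ c~w = nonNeighbour NV (notA c~w) (notB c~w) (≢-sym (adj⇒≢ c~w))
        a≁ : ∀ {z} → Adj G α z → ¬ Adj G a z
        a≁ α~z = nonNeighbour NA (distinctVia v≁α z~α) (distinctVia b≁α z~α) (≢-sym (adj⇒≢ α~z))
          where z~α = adj-sym′ α~z
        b≁ : ∀ {z} → Adj G β z → ¬ Adj G b z
        b≁ β~z = nonNeighbour NB (distinctVia v≁β z~β) (distinctVia a≁β z~β) (≢-sym (adj⇒≢ β~z))
          where z~β = adj-sym′ β~z

        outerNeighbour : ∀ {w} → Adj G c w → v ≢ w → All (w ≢_) (c ∷ b ∷ a ∷ v ∷ [])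
        outerNeighbour c~w v≢w = ≢-sym (adj⇒≢ c~w) ∷ notB c~w ∷ notA c~w ∷ ≢-sym v≢w ∷ []

        -- the other two neighbours of c are adjacent, as v is adjacent to neither
        sideEdge : ∀ {c₁ c₂} → Nbhd c v c₁ c₂ → Adj G c₁ c₂
        sideEdge Nc = clawFree⇒adjacent clawFree Nc (v≁ (Nc .adj₂)) (v≁ (Nc .adj₃))

        -- the six coloured vertices are not closed under taking neighbours
        notClosed : Adj G c α → Adj G c β → Adj G α β → ⊥
        notClosed c~α c~β α~β = noSmallClosed L₃ at0 closed (from-yes (6 <? 10))
          where
          Nβ : Nbhd β b c α
          Nβ = nbhdOf (adj-sym′ (NB .adj₃)) (adj-sym′ c~β) (adj-sym′ α~β) (≢-sym c≢b) (≢-sym α≢b) (≢-sym α≢c)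
          Nα : Nbhd α a c β
          Nα = nbhdOf (adj-sym′ (NA .adj₃)) (adj-sym′ c~α) α~β (≢-sym c≢a) (≢-sym β≢a) (≢-sym β≢c)
          Nc : Nbhd c v α β
          Nc = nbhdOf (adj-sym′ (NV .adj₃)) c~α c~β (≢-sym α≢v) (≢-sym β≢v) α≢β
          closed : ∀ {u x} → u ∈ₗ L₃ → Adj G u x → x ∈ₗ L₃
          closed at0 = coverIn Nβ at3 at2 at1
          closed at1 = coverIn Nα at4 at2 at0
          closed at2 = coverIn Nc at5 at1 at0
          closed at3 = coverIn NB at5 at4 at0
          closed at4 = coverIn NA at5 at3 at1
          closed at5 = coverIn NV at4 at3 at2

        -- If one of the other neighbours of c is already coloured (α or β),
        -- then c forces the last one.
        oneColoured : ∀ {t y} → Nbhd c v t y → t ≡ α ⊎ t ≡ β → Gain4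
        oneColoured {y = y} Nc (inj₁ refl) with y ≟ β
        ... | yes refl = ⊥-elim (notClosed (Nc .adj₂) (Nc .adj₃) (sideEdge Nc))
        ... | no y≢β = _ , forceL κ₃ Nc at2 at5 at1
                          (y≢β ∷ ≢-sym (Nc .distinct₂₃) ∷ outerNeighbour (Nc .adj₃) (Nc .distinct₁₃))
        oneColoured {y = y} Nc (inj₂ refl) with y ≟ α
        ... | yes refl = ⊥-elim (notClosed (Nc .adj₃) (Nc .adj₂) (adj-sym′ (sideEdge Nc)))
        ... | no y≢α = _ , forceL κ₃ Nc at2 at5 at0
                          (≢-sym (Nc .distinct₂₃) ∷ y≢α ∷ outerNeighbour (Nc .adj₃) (Nc .distinct₁₃))

        -- If the third neighbour x of c₁ is α (or β), with its neighbour y = a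
        -- (or b) sharing no neighbour with it, then claw-freeness at x makes x
        -- adjacent to c₂: c and x span a diamond on the edge c₁–c₂.
        diamondAtOuter : ∀ {c₁ c₂ x y} → Nbhd c v c₁ c₂ → Nbhd c₁ c c₂ x → Adj G x y → y ≢ c₁ →
                         (∀ {z} → Adj G x z → ¬ Adj G y z) → Gain4
        diamondAtOuter {x = x} Nc Nd x~y y≢c₁ y≁ =
          diamond (sideEdge Nc) (Nc .adj₂) (Nc .adj₃) x~c₁ (subst (Adj G x) z≡c₂ (Nx .adj₃)) (Nd .distinct₁₃)
          where
          x~c₁ = adj-sym′ (Nd .adj₃)
          Nx = proj₂ (complete x~y x~c₁ y≢c₁)
          c≁x : ¬ Adj G c x
          c≁x = nonNeighbour Nc (distinctVia (v≁ (Nc .adj₂)) x~c₁) (≢-sym (adj⇒≢ (Nd .adj₃))) (≢-sym (Nd .distinct₂₃))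
          z≡c₂ = thirdNeighbour≡ clawFree Nd Nx c≁x (y≁ (Nx .adj₂)) (y≁ (Nx .adj₃))

        -- Otherwise put c₁ into S and let c force c₂; then c₁ forces its
        -- third neighbour d, unless d is α or β.
        noneColoured : ∀ {c₁ c₂} → Nbhd c v c₁ c₂ → c₁ ≢ α → c₁ ≢ β → c₂ ≢ α → c₂ ≢ β → Gain4
        noneColoured {c₁} {c₂} Nc c₁≢α c₁≢β c₂≢α c₂≢β
          with complete (adj-sym′ (Nc .adj₂)) (sideEdge Nc) (adj⇒≢ (Nc .adj₃))
        ... | d , Nd with d ≟ α | d ≟ β
        ... | yes refl | _ = diamondAtOuter Nc Nd (adj-sym′ (NA .adj₃)) (≢-sym (notA (Nc .adj₂))) a≁
        ... | no _ | yes refl = diamondAtOuter Nc Nd (adj-sym′ (NB .adj₃)) (≢-sym (notB (Nc .adj₂))) b≁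
        ... | no d≢α | no d≢β = _ , forceL κ₄ Nd at1 at4 at0
              (≢-sym (Nd .distinct₂₃) ∷ ≢-sym (adj⇒≢ (Nd .adj₃)) ∷ d≢β ∷ d≢α ∷ ≢-sym (Nd .distinct₁₃) ∷
               distinctVia (nonNeighbour NB c₁≢v c₁≢a c₁≢β) d~c₁ ∷
               distinctVia (nonNeighbour NA c₁≢v c₁≢b c₁≢α) d~c₁ ∷ distinctVia (v≁ (Nc .adj₂)) d~c₁ ∷ [])
          where
          c₁≢v = ≢-sym (Nc .distinct₁₂) ; c₁≢a = notA (Nc .adj₂) ; c₁≢b = notB (Nc .adj₂)
          d~c₁ = adj-sym′ (Nd .adj₃)
          κ₄ : Config 3 (fromList (c₂ ∷ c₁ ∷ L₃))
          κ₄ = guessL κ₃ Nc at2 at5 (c₁≢β ∷ c₁≢α ∷ outerNeighbour (Nc .adj₂) (Nc .distinct₁₂))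
                                    (c₂≢β ∷ c₂≢α ∷ outerNeighbour (Nc .adj₃) (Nc .distinct₁₃))

        gain4 : Gain4
        gain4 with completeFrom (adj-sym′ (NV .adj₃))
        ... | c₁ , c₂ , Nc with c₁ ≟ α | c₁ ≟ β | c₂ ≟ α | c₂ ≟ β
        ... | yes c₁≡α | _        | _        | _        = oneColoured Nc (inj₁ c₁≡α)
        ... | no _     | yes c₁≡β | _        | _        = oneColoured Nc (inj₂ c₁≡β)
        ... | no _     | no _     | yes c₂≡α | _        = oneColoured (swap₂₃ Nc) (inj₁ c₂≡α)
        ... | no _     | no _     | no _     | yes c₂≡β = oneColoured (swap₂₃ Nc) (inj₂ c₂≡β)
        ... | no c₁≢α  | no c₁≢β  | no c₂≢α  | no c₂≢β  = noneColoured Nc c₁≢α c₁≢β c₂≢α c₂≢β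

      -- Every triangle v a b leads to gain 4: if two of the outer neighbours
      -- c (of v), α (of a), β (of b) coincide, they span a diamond with the
      -- triangle; otherwise the triangle is pendant.
      fromTriangle : ∀ {v a b c} → Nbhd v a b c → Adj G a b → Gain4
      fromTriangle {v} {a} {b} {c} NV a~b
        with complete (adj-sym′ (NV .adj₁)) a~b (adj⇒≢ (NV .adj₂))
           | complete (adj-sym′ (NV .adj₂)) (adj-sym′ a~b) (adj⇒≢ (NV .adj₁))
      ... | α , NA | β , NB with α ≟ c | β ≟ c | α ≟ β
      ... | yes refl | _ | _ =
        diamond (NV .adj₁) (adj-sym′ (NV .adj₂)) (adj-sym′ a~b) (adj-sym′ (NV .adj₃)) (adj-sym′ (NA .adj₃))
                (NV .distinct₂₃)
      ... | no _ | yes refl | _ =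
        diamond (NV .adj₂) (adj-sym′ (NV .adj₁)) a~b (adj-sym′ (NV .adj₃)) (adj-sym′ (NB .adj₃))
                (NV .distinct₁₃)
      ... | no _ | no _ | yes refl =
        diamond a~b (NV .adj₁) (NV .adj₂) (adj-sym′ (NA .adj₃)) (adj-sym′ (NB .adj₃)) (NA .distinct₁₃)
      ... | no α≢c | no β≢c | no α≢β = Pendant.gain4 NV NA NB α≢c β≢c α≢β

    smallForcingSet : ClawFree G → Connected G → 10 ≤ n → ∃[ S ] (ForcingSet G S × 2 * ∣ S ∣ < n)
    smallForcingSet clawFree connected big
      with triangleAt clawFree (fromℕ< {0} (≤-trans (s≤s z≤n) big))
    ... | _ , _ , _ , NV , a~b =
      belowHalf connected (proj₂ (LocalAnalysis.fromTriangle clawFree connected big NV a~b))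

corollary1 : (n : ℕ) → (G : Graph n) → Connected G → ClawFree G → Cubic G →
    10 ≤ n →
    Σ (Subset n) (λ S → ForcingSet G S × 2 * ∣ S ∣ < n)
corollary1 n G connected clawFree cubic = Graphs.CubicGraphs.smallForcingSet G cubic clawFree connected
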